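{- Let $\mathcal{G}=(\mathcal{V},\mathit{Act},\mathcal{R})$ be a normed BPA system with no silent variables, let $\mathcal{B}$ be a consistent base for $\mathcal{G}$, and let $R\in\mathrm{dom}(\mathcal{B})$. If $\alpha,\beta\in\mathcal{V}^*$ satisfy $\mathrm{PD}^{\mathcal{B}}_R(\alpha)=\mathrm{PD}^{\mathcal{B}}_R(\beta)\neq\varepsilon$, then $\mathrm{LM}^{\mathcal{B}}_R(\alpha)=\mathrm{LM}^{\mathcal{B}}_R(\beta)$.
   Context: A BPA system $\mathcal{G}=(\mathcal{V},\mathit{Act},\mathcal{R})$: finite variables $\mathcal{V}$, finite actions $\mathit{Act}$ (possibly containing the silent action $\tau$), finite rules $A\xrightarrow{a}\alpha$; its LTS has states $\mathcal{V}^*$ and transitions $A\beta\xrightarrow{a}\alpha\beta$ for each rule and each $\beta$; normed means every variable $A$ has $A\xrightarrow{w}\varepsilon$ for some $w$; a variable $A$ is silent if $A\xrightarrow{w}\alpha$ implies $w\in\{\tau\}^*$; $\|A\|$ is the length of a shortest $w$ with $A\xrightarrow{w}\varepsilon$. Pre-base: domain $\mathrm{dom}(\mathcal{B})\subseteq 2^{\mathcal{V}}$ with $\emptyset\in\mathrm{dom}(\mathcal{B})$, and disjoint sets $\mathcal{B}_{dec},\mathcal{B}_{prop}$ of triples $(A,\alpha,R)$ such that: (1) for each $R\in\mathrm{dom}(\mathcal{B})$, $\mathcal{V}\setminus R$ is partitioned into $(\mathcal{B},R)$-primes and $(\mathcal{B},R)$-non-primes; each $(\mathcal{B},R)$-non-prime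 $A$ has exactly one triple $(A,\alpha,R)\in\mathcal{B}_{dec}$, with $\alpha=\beta B$ for a $(\mathcal{B},R)$-prime $B$; each $(\mathcal{B},R)$-prime $B$ may have triples $(B,XB,R)\in\mathcal{B}_{prop}$, and $\mathrm{Red}^{\mathcal{B}}(B,R)=\{X\mid (B,XB,R)\in\mathcal{B}_{prop}\}$; (2) no other triples; (3) $\mathrm{dom}(\mathcal{B})$ is the least set containing $\emptyset$ and closed under $R\mapsto\mathrm{Red}^{\mathcal{B}}(B,R)$ for $(\mathcal{B},R)$-primes $B$. $\mathrm{PD}^{\mathcal{B}}_R$: $\mathrm{PD}^{\mathcal{B}}_R(\varepsilon)=\varepsilon$; $\mathrm{PD}^{\mathcal{B}}_R(\beta A)=\mathrm{PD}^{\mathcal{B}}_R(\beta)$ if $A\in R$; $=\mathrm{PD}^{\mathcal{B}}_{R'}(\beta)A$ with $R'=\mathrm{Red}^{\mathcal{B}}(A,R)$ if $A$ is a $(\mathcal{B},R)$-prime; $=\mathrm{PD}^{\mathcal{B}}_R(\beta\alpha)$ with $(A,\alpha,R)\in\mathcal{B}_{dec}$ if $A$ is a $(\mathcal{B},R)$-non-prime. A base is a pre-base with $|\mathrm{PD}^{\mathcal{B}}_R(A)|\le\|A\|$ for all $A$ and $R\in\mathrm{dom}(\mathcal{B})$, and $\alpha=\mathrm{PD}^{\mathcal{B}}_R(\alpha)$ for each $(A,\alpha,R)\in\mathcal{B}_{dec}$. $\alpha\equiv^{\mathcal{B}}_R\beta$ iff $\mathrm{PD}^{\mathcal{B}}_R(\alpha)=\mathrm{PD}^{\mathcal{B}}_R(\beta)$.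 $\mathrm{Red}^{\mathcal{B}}(\alpha,R)$ is extended to strings by: $\mathrm{Red}^{\mathcal{B}}(\varepsilon,R)=R$; $\mathrm{Red}^{\mathcal{B}}(\alpha B,R)=\mathrm{Red}^{\mathcal{B}}(\alpha,\mathrm{Red}^{\mathcal{B}}(B,R))$ if $B$ is a $(\mathcal{B},R)$-prime; $\mathrm{Red}^{\mathcal{B}}(\alpha,R)=\mathrm{Red}^{\mathcal{B}}(\mathrm{PD}^{\mathcal{B}}_R(\alpha),R)$ in general. Legal outcomes: $(a,\alpha')\in\mathrm{LM}^{\mathcal{B}}_R(\alpha)$ iff either $a=\tau$ and $\alpha'=\mathrm{PD}^{\mathcal{B}}_R(\alpha)$, or there is a path $\alpha=\alpha_0\xrightarrow{\tau}\cdots\xrightarrow{\tau}\alpha_k\xrightarrow{a}\alpha''$ ($k\ge0$) with $\alpha'=\mathrm{PD}^{\mathcal{B}}_R(\alpha'')$ and $\mathrm{PD}^{\mathcal{B}}_R(\alpha_i)=\mathrm{PD}^{\mathcal{B}}_R(\alpha)$ for $1\le i\le k$. A base is consistent if for every triple $(A,\alpha,R)\in\mathcal{B}_{dec}\cup\mathcal{B}_{prop}$ we have $A\equiv^{\mathcal{B}}_R\alpha$ and $\mathrm{LM}^{\mathcal{B}}_R(A)=\mathrm{LM}^{\mathcal{B}}_R(\alpha)$. -}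

module Defs where

open import Data.Nat using (ℕ; _≤_)
open import Data.Fin using (Fin)
open import Data.Fin.Subset using (Subset; ⊥) renaming (_∈_ to _∈ˢ_; _∉_ to _∉ˢ_)
open import Data.Bool using (Bool; true; false)
open import Data.List using (List; []; _∷_; _++_; _∷ʳ_; length)
open import Data.List.Membership.Propositional using (_∈_)
open import Data.List.Relation.Unary.All using (All)
open import Data.Product using (Σ; ∃; ∃-syntax; _×_; _,_)
open import Relation.Binary.PropositionalEquality using (_≡_)
open import Relation.Nullary using (¬_)
open import Function.Bundles using (_⇔_)

-- Variables are Fin n, visible actions are Fin m, and the
-- silent action τ is always available as a label (a system "not
-- containing τ" simply has no τ-rules).  Strings are lists, leftmost
-- symbol first.

data Label (m : ℕ) : Set where
  tau : Label m
  act : Fin m → Label m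

record BPA (n m : ℕ) : Set where
  field
    rules : List (Fin n × Label m × List (Fin n))

module _ {n m : ℕ} (G : BPA n m) where
  open BPA G

  data Step : List (Fin n) → Label m → List (Fin n) → Set where
    step : ∀ {A a α β} → (A , a , α) ∈ rules → Step (A ∷ β) a (α ++ β)

  data Steps : List (Fin n) → List (Label m) → List (Fin n) → Set where
    done : ∀ {α} → Steps α [] α
    more : ∀ {α α₁ α' a w} → Step α a α₁ → Steps α₁ w α' → Steps α (a ∷ w) α'

  Normed : Set
  Normed = ∀ (A : Fin n) → ∃[ w ] Steps (A ∷ []) w []

  Silent : Fin n → Set
  Silent A = ∀ w α → Steps (A ∷ []) w α → All (_≡ tau) w

  NoSilentVariables : Set
  NoSilentVariables = ∀ (A : Fin n) → ¬ Silent A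

  IsNorm : Fin n → ℕ → Set
  IsNorm A k = (∃[ w ] (Steps (A ∷ []) w [] × length w ≡ k))
             × (∀ w → Steps (A ∷ []) w [] → k ≤ length w)

-- For each R, a variable A ∉ R is a (B,R)-prime when
-- isPrime R A ≡ true and a (B,R)-non-prime otherwise (this realises the
-- partition of V \ R).  The unique decomposition triple of a non-prime A
-- is (A , dec R A , R); the propagation triples of a prime B are exactly
-- (B , X B , R) for X ∈ red R B, so Red(B,R) = red R B.

record PreBaseData (n : ℕ) : Set where
  field
    isPrime : Subset n → Fin n → Bool
    dec     : Subset n → Fin n → List (Fin n)
    red     : Subset n → Fin n → Subset n

module _ {n : ℕ} (B : PreBaseData n) where
  open PreBaseData B

  IsPrimeR : Subset n → Fin n → Set
  IsPrimeR R A = A ∉ˢ R × isPrime R A ≡ true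

  NonPrimeR : Subset n → Fin n → Set
  NonPrimeR R A = A ∉ˢ R × isPrime R A ≡ false

  data Dom : Subset n → Set where
    dom-∅   : Dom ⊥
    dom-red : ∀ {R A} → Dom R → IsPrimeR R A → Dom (red R A)

  IsPreBase : Set
  IsPreBase = ∀ R → Dom R → ∀ A → NonPrimeR R A →
              ∃[ β ] ∃[ C ] (dec R A ≡ β ∷ʳ C × IsPrimeR R C)

  -- PD_R(α) ≡ γ, as the graph of the recursive definition
  data PD : Subset n → List (Fin n) → List (Fin n) → Set where
    pd-ε     : ∀ {R} → PD R [] []
    pd-in    : ∀ {R β A γ} → A ∈ˢ R → PD R β γ → PD R (β ∷ʳ A) γ
    pd-prime : ∀ {R β A γ} → IsPrimeR R A → PD (red R A) β γ →
               PD R (β ∷ʳ A) (γ ∷ʳ A)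
    pd-non   : ∀ {R β A γ} → NonPrimeR R A → PD R (β ++ dec R A) γ →
               PD R (β ∷ʳ A) γ

  Equiv : Subset n → List (Fin n) → List (Fin n) → Set
  Equiv R α β = ∃[ γ ] (PD R α γ × PD R β γ)

module _ {n m : ℕ} (G : BPA n m) (B : PreBaseData n) where
  open PreBaseData B

  IsBase : Set
  IsBase = IsPreBase B
         × (∀ R → Dom B R → ∀ A → ∃[ γ ] (PD B R (A ∷ []) γ
                                × (∀ k → IsNorm G A k → length γ ≤ k)))
         × (∀ R → Dom B R → ∀ A → NonPrimeR B R A → PD B R (dec R A) (dec R A))

  data TauPath (R : Subset n) (α : List (Fin n)) : List (Fin n) → List (Fin n) → Set where
    tp-here : ∀ {δ} → TauPath R α δ δ
    tp-step : ∀ {δ δ₁ δₖ} → Step G δ tau δ₁ → Equiv B R δ₁ α →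
              TauPath R α δ₁ δₖ → TauPath R α δ δₖ

  data LM (R : Subset n) (α : List (Fin n)) : Label m → List (Fin n) → Set where
    lm-τ    : ∀ {α'} → PD B R α α' → LM R α tau α'
    lm-path : ∀ {αₖ α'' a α'} → TauPath R α α αₖ → Step G αₖ a α'' →
              PD B R α'' α' → LM R α a α'

  LMEq : Subset n → List (Fin n) → List (Fin n) → Set
  LMEq R α β = ∀ a α' → LM R α a α' ⇔ LM R β a α'

  Consistent : Set
  Consistent =
      (∀ R → Dom B R → ∀ A → NonPrimeR B R A →
         Equiv B R (A ∷ []) (dec R A) × LMEq R (A ∷ []) (dec R A))
    × (∀ R → Dom B R → ∀ C → IsPrimeR B R C → ∀ X → X ∈ˢ red R C →
         Equiv B R (C ∷ []) (X ∷ C ∷ []) × LMEq R (C ∷ []) (X ∷ C ∷ []))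

-- It suffices to show LM_R(α) = LM_R(PD_R(α)) whenever PD_R(α) ≠ ε, by induction on the
-- computation of PD_R(α). Every step rewrites a suffix ρ of δρ into some ρ' with the same
-- output PD_R and the same residual state R' = Red(ρ,R) for δ, and two congruences move
-- equalities of legal moves through such contexts. If PD_{R'}(δ) ≠ ε, no τ-path from δρ
-- reaches ρ, so the legal moves of δρ are those of δ (in state R') followed by PD_R(ρ).
-- If LM_R(ρ) = LM_R(ρ'), a τ-path from δρ either stays inside δ, and is copied to δρ', or
-- empties δ, in which case PD_{R'}(δ) = ε and the rest is a legal move of ρ, hence of ρ'.
-- Consistency gives LM_R(A) = LM_R(dec_R A) for a non-prime A and LM_R(XC) = LM_R(C) for
-- X ∈ Red(C,R). A prefix β with PD_{Red(C,R)}(β) = ε consists of such X only, because the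
-- decomposition of a non-prime ends in a prime; so a prime C absorbs it.
module Submission where

open import Defs
open import Data.Nat using (ℕ)
open import Data.List using (List; []; _∷_; _++_; _∷ʳ_; [_])
open import Data.List.Properties using (++-assoc; ++-identityʳ; ∷ʳ-injective; ++-cancelʳ)
open import Data.List.Reverse using (reverseView; []; _∶_∶ʳ_)
open import Data.Fin using (Fin)
open import Data.Fin.Subset using (Subset) renaming (_∈_ to _∈ˢ_)
open import Data.Product using (∃₂; ∃-syntax; _×_; _,_; proj₁; proj₂)
open import Data.Sum using (_⊎_; inj₁; inj₂)
open import Data.Empty using (⊥-elim)
open import Relation.Nullary using (¬_)
open import Relation.Binary.PropositionalEquality
  using (_≡_; refl; sym; trans; cong; subst; subst₂; _≢_)
open import Function.Construct.Identity using (⇔-id)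
open import Function.Construct.Symmetry using (⇔-sym)
open import Function.Construct.Composition using (_⇔-∘_)
open import Function.Bundles using (mk⇔; Equivalence)

∷ʳ≢[] : ∀ {A : Set} {xs : List A} {x} → xs ∷ʳ x ≢ []
∷ʳ≢[] {xs = []} ()
∷ʳ≢[] {xs = _ ∷ _} ()

module _ {n : ℕ} (B : PreBaseData n) where
  open PreBaseData B

  private
    L : Set
    L = List (Fin n)

  prime⇒¬nonPrime : ∀ {R A} → IsPrimeR B R A → ¬ NonPrimeR B R A
  prime⇒¬nonPrime (_ , t) (_ , f) with () ← trans (sym t) f

  -- PDSuffix R ρ R' γ: PD_R(ρ) = γ and Red(ρ,R) = R', so that PD_R(δρ) = PD_{R'}(δ) γ.
  data PDSuffix : Subset n → L → Subset n → L → Set where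
    s-ε     : ∀ {R} → PDSuffix R [] R []
    s-in    : ∀ {R β A R' γ} → A ∈ˢ R → PDSuffix R β R' γ → PDSuffix R (β ∷ʳ A) R' γ
    s-prime : ∀ {R β A R' γ} → IsPrimeR B R A → PDSuffix (red R A) β R' γ →
              PDSuffix R (β ∷ʳ A) R' (γ ∷ʳ A)
    s-non   : ∀ {R β A R' γ} → NonPrimeR B R A → PDSuffix R (β ++ dec R A) R' γ →
              PDSuffix R (β ∷ʳ A) R' γ

  pdSuffix-functional : ∀ {R x R₁ R₂ γ γ'} → PDSuffix R x R₁ γ → PDSuffix R x R₂ γ' →
                        R₁ ≡ R₂ × γ ≡ γ'
  pdSuffix-functional s s' = go s s' refl
    where
    go : ∀ {R x y R₁ R₂ γ γ'} → PDSuffix R x R₁ γ → PDSuffix R y R₂ γ' → x ≡ y →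
         R₁ ≡ R₂ × γ ≡ γ'
    go s-ε s-ε _ = refl , refl
    go s-ε (s-in _ _) e = ⊥-elim (∷ʳ≢[] (sym e))
    go s-ε (s-prime _ _) e = ⊥-elim (∷ʳ≢[] (sym e))
    go s-ε (s-non _ _) e = ⊥-elim (∷ʳ≢[] (sym e))
    go (s-in _ _) s-ε e = ⊥-elim (∷ʳ≢[] e)
    go (s-prime _ _) s-ε e = ⊥-elim (∷ʳ≢[] e)
    go (s-non _ _) s-ε e = ⊥-elim (∷ʳ≢[] e)
    go (s-in a s) (s-in _ s') e with refl , refl ← ∷ʳ-injective _ _ e = go s s' refl
    go (s-in a _) (s-prime p _) e with refl , refl ← ∷ʳ-injective _ _ e = ⊥-elim (proj₁ p a)
    go (s-in a _) (s-non q _) e with refl , refl ← ∷ʳ-injective _ _ e = ⊥-elim (proj₁ q a)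
    go (s-prime p _) (s-in a _) e with refl , refl ← ∷ʳ-injective _ _ e = ⊥-elim (proj₁ p a)
    go (s-prime _ s) (s-prime _ s') e with refl , refl ← ∷ʳ-injective _ _ e
      with refl , refl ← go s s' refl = refl , refl
    go (s-prime p _) (s-non q _) e with refl , refl ← ∷ʳ-injective _ _ e =
      ⊥-elim (prime⇒¬nonPrime p q)
    go (s-non q _) (s-in a _) e with refl , refl ← ∷ʳ-injective _ _ e = ⊥-elim (proj₁ q a)
    go (s-non q _) (s-prime p _) e with refl , refl ← ∷ʳ-injective _ _ e =
      ⊥-elim (prime⇒¬nonPrime p q)
    go (s-non _ s) (s-non _ s') e with refl , refl ← ∷ʳ-injective _ _ e = go s s' refl

  pd⇒pdSuffix : ∀ {R α γ} → PD B R α γ → ∃[ R' ] PDSuffix R α R' γ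
  pd⇒pdSuffix pd-ε = _ , s-ε
  pd⇒pdSuffix (pd-in a d) = let R' , s = pd⇒pdSuffix d in R' , s-in a s
  pd⇒pdSuffix (pd-prime p d) = let R' , s = pd⇒pdSuffix d in R' , s-prime p s
  pd⇒pdSuffix (pd-non q d) = let R' , s = pd⇒pdSuffix d in R' , s-non q s

  pd-functional : ∀ {R α γ γ'} → PD B R α γ → PD B R α γ' → γ ≡ γ'
  pd-functional d d' = proj₂ (pdSuffix-functional (proj₂ (pd⇒pdSuffix d)) (proj₂ (pd⇒pdSuffix d')))

  pd-idempotent : ∀ {R α γ} → PD B R α γ → PD B R γ γ
  pd-idempotent pd-ε = pd-ε
  pd-idempotent (pd-in _ d) = pd-idempotent d
  pd-idempotent (pd-prime p d) = pd-prime p (pd-idempotent d)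
  pd-idempotent (pd-non _ d) = pd-idempotent d

  pd-++ : ∀ {R ρ R' γ₂ δ γ₁} → PDSuffix R ρ R' γ₂ → PD B R' δ γ₁ → PD B R (δ ++ ρ) (γ₁ ++ γ₂)
  pd-++ {δ = δ} {γ₁} s-ε d = subst₂ (PD B _) (sym (++-identityʳ δ)) (sym (++-identityʳ γ₁)) d
  pd-++ {δ = δ} (s-in {β = β} {A} a s) d =
    subst (λ x → PD B _ x _) (++-assoc δ β [ A ]) (pd-in a (pd-++ s d))
  pd-++ {δ = δ} {γ₁} (s-prime {β = β} {A} {γ = γ} p s) d =
    subst₂ (PD B _) (++-assoc δ β [ A ]) (++-assoc γ₁ γ [ A ]) (pd-prime p (pd-++ s d))
  pd-++ {R} {δ = δ} (s-non {β = β} {A} q s) d =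
    subst (λ x → PD B _ x _) (++-assoc δ β [ A ])
      (pd-non q (subst (λ x → PD B R x _) (sym (++-assoc δ β (dec R A))) (pd-++ s d)))

  pd-split : ∀ {R γ} δ ρ → PD B R (δ ++ ρ) γ →
             ∃₂ λ R' γ₂ → ∃[ γ₁ ] (PDSuffix R ρ R' γ₂ × PD B R' δ γ₁ × γ ≡ γ₁ ++ γ₂)
  pd-split δ ρ d = go d δ ρ refl
    where
    go : ∀ {R x γ} → PD B R x γ → ∀ δ ρ → x ≡ δ ++ ρ →
         ∃₂ λ R' γ₂ → ∃[ γ₁ ] (PDSuffix R ρ R' γ₂ × PD B R' δ γ₁ × γ ≡ γ₁ ++ γ₂)
    go {R} {γ = γ} d δ ρ e with reverseView ρ
    ... | [] = R , [] , γ , s-ε , subst (λ x → PD B R x γ) (trans e (++-identityʳ δ)) d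
                                , sym (++-identityʳ γ)
    go pd-ε δ _ e | ρ₀ ∶ _ ∶ʳ z = ⊥-elim (∷ʳ≢[] (sym (trans e (sym (++-assoc δ ρ₀ [ z ])))))
    go (pd-in a d) δ _ e | ρ₀ ∶ _ ∶ʳ z
      with refl , refl ← ∷ʳ-injective _ _ (trans e (sym (++-assoc δ ρ₀ [ z ]))) =
      let R' , γ₂ , γ₁ , s , dδ , eq = go d δ ρ₀ refl in R' , γ₂ , γ₁ , s-in a s , dδ , eq
    go (pd-prime p d) δ _ e | ρ₀ ∶ _ ∶ʳ z
      with refl , refl ← ∷ʳ-injective _ _ (trans e (sym (++-assoc δ ρ₀ [ z ]))) =
      let R' , γ₂ , γ₁ , s , dδ , eq = go d δ ρ₀ refl
      in R' , γ₂ ∷ʳ z , γ₁ , s-prime p s , dδ , trans (cong (_∷ʳ z) eq) (++-assoc γ₁ γ₂ [ z ])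
    go {R} (pd-non q d) δ _ e | ρ₀ ∶ _ ∶ʳ z
      with refl , refl ← ∷ʳ-injective _ _ (trans e (sym (++-assoc δ ρ₀ [ z ]))) =
      let R' , γ₂ , γ₁ , s , dδ , eq = go d δ (ρ₀ ++ dec R z) (++-assoc δ ρ₀ (dec R z))
      in R' , γ₂ , γ₁ , s-non q s , dδ , eq

  pd-∷ʳ-prime : ∀ {R β C γ} → PD B R (β ∷ʳ C) γ → IsPrimeR B R C → γ ≢ []
  pd-∷ʳ-prime d = go d refl
    where
    go : ∀ {R x β C γ} → PD B R x γ → x ≡ β ∷ʳ C → IsPrimeR B R C → γ ≢ []
    go pd-ε e _ = ⊥-elim (∷ʳ≢[] (sym e))
    go (pd-in a _) e p with refl , refl ← ∷ʳ-injective _ _ e = ⊥-elim (proj₁ p a)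
    go (pd-prime _ _) _ _ = ∷ʳ≢[]
    go (pd-non q _) e p with refl , refl ← ∷ʳ-injective _ _ e = ⊥-elim (prime⇒¬nonPrime p q)

  pd-≢[] : ∀ {R α γ} → PD B R α γ → γ ≢ [] → α ≢ []
  pd-≢[] d γ≢[] refl = γ≢[] (pd-functional d pd-ε)

  equiv-sym : ∀ {R x y} → Equiv B R x y → Equiv B R y x
  equiv-sym (γ , dx , dy) = γ , dy , dx

  equiv-trans : ∀ {R x y z} → Equiv B R x y → Equiv B R y z → Equiv B R x z
  equiv-trans (γ , dx , dy) (γ' , dy' , dz) with refl ← pd-functional dy dy' = γ , dx , dz

  equiv-[]⇒pd : ∀ {R x} → Equiv B R [] x → PD B R x []
  equiv-[]⇒pd (γ , d[] , dx) with refl ← pd-functional d[] pd-ε = dx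

module _ {n m : ℕ} (G : BPA n m) (B : PreBaseData n) where
  lmEq-sym : ∀ {R α β} → LMEq G B R α β → LMEq G B R β α
  lmEq-sym e a x = ⇔-sym (e a x)

  lmEq-trans : ∀ {R α β γ} → LMEq G B R α β → LMEq G B R β γ → LMEq G B R α γ
  lmEq-trans e f a x = f a x ⇔-∘ e a x

  step-++ʳ : ∀ {x a y} ρ → Step G x a y → Step G (x ++ ρ) a (y ++ ρ)
  step-++ʳ ρ (step {a = a} {α} {β} r) = subst (Step G _ a) (sym (++-assoc α β ρ)) (step r)

  step-++ʳ⁻ : ∀ {δ a y} ρ → δ ≢ [] → Step G (δ ++ ρ) a y → ∃[ δ' ] (Step G δ a δ' × y ≡ δ' ++ ρ)
  step-++ʳ⁻ {[]} ρ δ≢[] _ = ⊥-elim (δ≢[] refl)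
  step-++ʳ⁻ {_ ∷ δ} ρ _ (step {α = α} r) = α ++ δ , step r , sym (++-assoc α δ ρ)

  tauPath-trans : ∀ {R o a b c} → TauPath G B R o a b → TauPath G B R o b c → TauPath G B R o a c
  tauPath-trans tp-here q = q
  tauPath-trans (tp-step st e p) q = tp-step st e (tauPath-trans p q)

  tauPath-reorigin : ∀ {R o₁ o₂ a b} → Equiv B R o₁ o₂ →
                     TauPath G B R o₁ a b → TauPath G B R o₂ a b
  tauPath-reorigin _ tp-here = tp-here
  tauPath-reorigin o₁≈o₂ (tp-step st e p) =
    tp-step st (equiv-trans B e o₁≈o₂) (tauPath-reorigin o₁≈o₂ p)

  lm-via-τ : ∀ {R o s a x} → TauPath G B R o o s → Equiv B R s o → LM G B R s a x → LM G B R o a x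
  lm-via-τ _ (γ , ds , dₒ) (lm-τ d) with refl ← pd-functional B d ds = lm-τ dₒ
  lm-via-τ tp s≈o (lm-path tp' st d) = lm-path (tauPath-trans tp (tauPath-reorigin s≈o tp')) st d

  module Context {R ρ R' γ₂} (s : PDSuffix B R ρ R' γ₂) where

    equiv-++ʳ : ∀ {x y} → Equiv B R' x y → Equiv B R (x ++ ρ) (y ++ ρ)
    equiv-++ʳ (γ , dx , dy) = γ ++ γ₂ , pd-++ B s dx , pd-++ B s dy

    pd-++⁻ : ∀ {δ γ} → PD B R (δ ++ ρ) γ → ∃[ γ₁ ] (PD B R' δ γ₁ × γ ≡ γ₁ ++ γ₂)
    pd-++⁻ {δ} d with pd-split B δ ρ d
    ... | _ , _ , γ₁ , s' , dδ , eq with refl , refl ← pdSuffix-functional B s s' = γ₁ , dδ , eq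

    equiv-++ʳ⁻ : ∀ {x y} → Equiv B R (x ++ ρ) (y ++ ρ) → Equiv B R' x y
    equiv-++ʳ⁻ (γ , dx , dy) with pd-++⁻ dx | pd-++⁻ dy
    ... | γ₁ , dx' , eq | γ₁' , dy' , eq' with refl ← ++-cancelʳ γ₂ γ₁ γ₁' (trans (sym eq) eq') =
      γ₁ , dx' , dy'

    tauPath-++ʳ : ∀ {δ a b} → TauPath G B R' δ a b → TauPath G B R (δ ++ ρ) (a ++ ρ) (b ++ ρ)
    tauPath-++ʳ tp-here = tp-here
    tauPath-++ʳ (tp-step st e p) = tp-step (step-++ʳ ρ st) (equiv-++ʳ e) (tauPath-++ʳ p)

    lm-++ʳ : ∀ {δ a y} → LM G B R' δ a y → LM G B R (δ ++ ρ) a (y ++ γ₂)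
    lm-++ʳ (lm-τ d) = lm-τ (pd-++ B s d)
    lm-++ʳ (lm-path tp st d) = lm-path (tauPath-++ʳ tp) (step-++ʳ ρ st) (pd-++ B s d)

    tauPath-++ʳ⁻ : ∀ {δ s₀ t} → s₀ ≢ [] → TauPath G B R (δ ++ ρ) (s₀ ++ ρ) t →
                   (∃[ t₀ ] (t₀ ≢ [] × TauPath G B R' δ s₀ t₀ × t ≡ t₀ ++ ρ))
                 ⊎ (Equiv B R' [] δ × TauPath G B R' δ s₀ [] × TauPath G B R (δ ++ ρ) ρ t)
    tauPath-++ʳ⁻ s₀≢[] tp-here = inj₁ (_ , s₀≢[] , tp-here , refl)
    tauPath-++ʳ⁻ s₀≢[] (tp-step st e tp) with step-++ʳ⁻ ρ s₀≢[] st
    ... | [] , st₀ , refl = inj₂ (equiv-++ʳ⁻ e , tp-step st₀ (equiv-++ʳ⁻ e) tp-here , tp)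
    ... | _ ∷ _ , st₀ , refl with tauPath-++ʳ⁻ (λ ()) tp
    ...   | inj₁ (t₀ , t₀≢[] , tp₀ , eq) =
      inj₁ (t₀ , t₀≢[] , tp-step st₀ (equiv-++ʳ⁻ e) tp₀ , eq)
    ...   | inj₂ (δ≈ε , tp₀ , tpρ) = inj₂ (δ≈ε , tp-step st₀ (equiv-++ʳ⁻ e) tp₀ , tpρ)

    lm-++ʳ⁻ : ∀ {δ a x} → δ ≢ [] → LM G B R (δ ++ ρ) a x →
              (∃[ y ] (LM G B R' δ a y × x ≡ y ++ γ₂))
            ⊎ (Equiv B R' [] δ × TauPath G B R' δ δ [] × LM G B R ρ a x)
    lm-++ʳ⁻ _ (lm-τ d) = let y , dδ , eq = pd-++⁻ d in inj₁ (y , lm-τ dδ , eq)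
    lm-++ʳ⁻ δ≢[] (lm-path tp st d) with tauPath-++ʳ⁻ δ≢[] tp
    ... | inj₂ (δ≈ε , tp₀ , tpρ) =
      inj₂ (δ≈ε , tp₀ , lm-path (tauPath-reorigin (equiv-sym B (equiv-++ʳ δ≈ε)) tpρ) st d)
    ... | inj₁ (t₀ , t₀≢[] , tp₀ , refl) with step-++ʳ⁻ ρ t₀≢[] st
    ...   | _ , st₀ , refl = let y , d' , eq = pd-++⁻ d in inj₁ (y , lm-path tp₀ st₀ d' , eq)

  lm-++-⊆ : ∀ {R ρ ρ' R' γ₂ δ δ' γ₁} → PDSuffix B R ρ R' γ₂ → PDSuffix B R ρ' R' γ₂ →
            PD B R' δ γ₁ → γ₁ ≢ [] → LMEq G B R' δ δ' →
            ∀ {a x} → LM G B R (δ ++ ρ) a x → LM G B R (δ' ++ ρ') a x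
  lm-++-⊆ s s' dδ γ₁≢[] δ≈δ' h with Context.lm-++ʳ⁻ s (pd-≢[] B dδ γ₁≢[]) h
  ... | inj₁ (y , h' , refl) = Context.lm-++ʳ s' (Equivalence.to (δ≈δ' _ y) h')
  ... | inj₂ (δ≈ε , _) = ⊥-elim (γ₁≢[] (pd-functional B dδ (equiv-[]⇒pd B δ≈ε)))

  lmEq-++ : ∀ {R ρ ρ' R' γ₂ δ δ' γ₁} → PDSuffix B R ρ R' γ₂ → PDSuffix B R ρ' R' γ₂ →
            PD B R' δ γ₁ → PD B R' δ' γ₁ → γ₁ ≢ [] → LMEq G B R' δ δ' →
            LMEq G B R (δ ++ ρ) (δ' ++ ρ')
  lmEq-++ s s' dδ dδ' γ₁≢[] δ≈δ' _ _ =
    mk⇔ (lm-++-⊆ s s' dδ γ₁≢[] δ≈δ') (lm-++-⊆ s' s dδ' γ₁≢[] (lmEq-sym δ≈δ'))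

  lm-prefix-⊆ : ∀ {R ρ ρ' R' γ₂} → PDSuffix B R ρ R' γ₂ → PDSuffix B R ρ' R' γ₂ →
                LMEq G B R ρ ρ' → ∀ δ {a x} → LM G B R (δ ++ ρ) a x → LM G B R (δ ++ ρ') a x
  lm-prefix-⊆ _ _ ρ≈ρ' [] h = Equivalence.to (ρ≈ρ' _ _) h
  lm-prefix-⊆ s s' ρ≈ρ' (_ ∷ _) h with Context.lm-++ʳ⁻ s (λ ()) h
  ... | inj₁ (y , h' , refl) = Context.lm-++ʳ s' h'
  ... | inj₂ (δ≈ε , tp , hρ) =
    lm-via-τ (Context.tauPath-++ʳ s' tp) (Context.equiv-++ʳ s' δ≈ε) (Equivalence.to (ρ≈ρ' _ _) hρ)

  lmEq-prefix : ∀ {R ρ ρ' R' γ₂} → PDSuffix B R ρ R' γ₂ → PDSuffix B R ρ' R' γ₂ →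
                LMEq G B R ρ ρ' → ∀ δ → LMEq G B R (δ ++ ρ) (δ ++ ρ')
  lmEq-prefix s s' ρ≈ρ' δ _ _ =
    mk⇔ (lm-prefix-⊆ s s' ρ≈ρ' δ) (lm-prefix-⊆ s' s (lmEq-sym ρ≈ρ') δ)

module _ {n m : ℕ} (G : BPA n m) (B : PreBaseData n)
         (preBase : IsPreBase B) (consistent : Consistent G B) where
  open PreBaseData B

  lmEq-absorb : ∀ {R C β γ} → Dom B R → IsPrimeR B R C → PD B (red R C) β γ → γ ≡ [] →
                LMEq G B R (β ∷ʳ C) [ C ]
  lmEq-absorb _ _ pd-ε _ _ _ = ⇔-id _
  lmEq-absorb {R} {C} dR p (pd-in {β = β} {X} x d) γ≡[] =
    lmEq-trans G B
      (subst (λ α → LMEq G B R α (β ∷ʳ C)) (sym (++-assoc β [ X ] [ C ]))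
        (lmEq-prefix G B (s-prime p (s-in x s-ε)) (s-prime p s-ε) XC≈C β))
      (lmEq-absorb dR p d γ≡[])
    where
    XC≈C : LMEq G B R (X ∷ C ∷ []) [ C ]
    XC≈C = lmEq-sym G B (proj₂ (proj₂ consistent R dR C p X x))
  lmEq-absorb _ _ (pd-prime _ _) γ≡[] = ⊥-elim (∷ʳ≢[] γ≡[])
  lmEq-absorb {R} {C} dR p (pd-non {β = β} {Y} q d) γ≡[]
    with β' , C' , decY , pC' ← preBase (red R C) (dom-red dR p) Y q =
    ⊥-elim (pd-∷ʳ-prime B (subst (λ α → PD B _ α _) β++decY≡ d) pC' γ≡[])
    where
    β++decY≡ : β ++ dec (red R C) Y ≡ (β ++ β') ∷ʳ C'
    β++decY≡ = trans (cong (β ++_) decY) (sym (++-assoc β β' [ C' ]))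

  lmEq-pd : ∀ {R α γ} → Dom B R → PD B R α γ → γ ≢ [] → LMEq G B R α γ
  lmEq-pd _ pd-ε γ≢[] = ⊥-elim (γ≢[] refl)
  lmEq-pd {R} dR (pd-in {β = β} {A} {γ} a d) γ≢[] =
    subst (LMEq G B R (β ∷ʳ A)) (++-identityʳ γ)
      (lmEq-++ G B (s-in a s-ε) s-ε d (pd-idempotent B d) γ≢[] (lmEq-pd dR d γ≢[]))
  lmEq-pd dR (pd-prime {γ = []} p d) _ = lmEq-absorb dR p d refl
  lmEq-pd dR (pd-prime {γ = _ ∷ _} p d) _ =
    lmEq-++ G B (s-prime p s-ε) (s-prime p s-ε) d (pd-idempotent B d) (λ ())
      (lmEq-pd (dom-red dR p) d (λ ()))
  lmEq-pd {R} dR (pd-non {β = β} {A} q d) γ≢[] =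
    let _ , _ , _ , s , _ = pd-split B β (dec R A) d
    in lmEq-trans G B (lmEq-prefix G B (s-non {β = []} q s) s A≈decA β) (lmEq-pd dR d γ≢[])
    where
    A≈decA : LMEq G B R [ A ] (dec R A)
    A≈decA = proj₂ (proj₁ consistent R dR A q)

proposition9 : ∀ {n m} (G : BPA n m) → Normed G → NoSilentVariables G →
    (B : PreBaseData n) → IsBase G B → Consistent G B →
    (R : Subset n) → Dom B R →
    (α β γ : List (Fin n)) → PD B R α γ → PD B R β γ → γ ≢ [] →
    LMEq G B R α β
proposition9 G _ _ B (preBase , _) consistent R dR α β γ dα dβ γ≢[] =
  lmEq-trans G B (lmEq-pd G B preBase consistent dR dα γ≢[])
    (lmEq-sym G B (lmEq-pd G B preBase consistent dR dβ γ≢[]))
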